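{- Let $\mathbb{T}\in\{0,1\}^{\mathbb N}$ be the Thue–Morse word. For each integer $n>0$ there exists a factor $u$ of $\mathbb{T}$ with $\mu(u)\ge n$; that is, $\psi(\mathbb{T})=+\infty$.
   Context: The Thue–Morse word $\mathbb{T}=t_0t_1t_2\cdots=0110100110010110\cdots$ has $t_n$ equal to the sum modulo $2$ of the binary digits of $n$; equivalently it is the fixed point starting with $0$ of the morphism $0\mapsto 01$, $1\mapsto 10$. For $u=u_1\cdots u_m$, $u[i,j]=u_i\cdots u_j$; $\mathcal{S}(m)=\{(i,j)\mid 1\le i\le j\le m\}$; $\mathrm{alph}(u)$ is the set of letters of $u$. A set $S\subseteq\mathcal{S}(m)$ palindromically generates $u$ of length $m$ if (1) $u[i,j]$ is a palindrome for all $(i,j)\in S$, and (2) for every nonempty set $\mathbb{B}$ and every $v\in\mathbb{B}^m$ with $v[i,j]$ a palindrome for all $(i,j)\in S$, there is a map $c\colon\mathrm{alph}(u)\to\mathbb{B}$ whose extension to a morphism satisfies $c(u)=v$. $\mu(u)$ is the minimal cardinality of such $S$ ($+\infty$ if none). $\psi(x)=\sup\{\mu(u)\mid u\text{ a finite nonempty factor of }x\}$. -}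

module Defs where

open import Data.Bool using (Bool; true; false; _xor_)
open import Data.Nat using (ℕ; zero; suc; _+_; _∸_; _≤_; _<_; _≟_)
open import Data.Nat.Base using (_/_; _%_)
open import Data.List using (List; map; upTo; take; drop; reverse; length)
open import Data.List.Membership.Propositional using (_∈_)
open import Data.List.Relation.Unary.All using (All)
open import Data.List.Relation.Unary.Unique.Propositional using (Unique)
open import Data.Product using (_×_; _,_; Σ; ∃)
open import Relation.Binary.PropositionalEquality using (_≡_)
open import Relation.Nullary using (¬_; does)

tmAux : ℕ → ℕ → Bool
tmAux zero    n = false
tmAux (suc f) n = does ((n % 2) ≟ 1) xor tmAux f (n / 2)

-- Thue–Morse word: t n = sum mod 2 of binary digits of n (false = 0, true = 1)
tm : ℕ → Bool
tm n = tmAux n n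

tmFactor : ℕ → ℕ → List Bool
tmFactor k m = map (λ i → tm (k + i)) (upTo m)

IsPalindrome : {A : Set} → List A → Set
IsPalindrome w = reverse w ≡ w

-- w[i,j] = w_i ... w_j (1-indexed)
sub : {A : Set} → List A → ℕ × ℕ → List A
sub w (i , j) = take (suc j ∸ i) (drop (i ∸ 1) w)

InS : ℕ → ℕ × ℕ → Set
InS m (i , j) = (1 ≤ i) × (i ≤ j) × (j ≤ m)

PalGenerates : List (ℕ × ℕ) → List Bool → Set₁
PalGenerates S u =
  (∀ p → p ∈ S → IsPalindrome (sub u p)) ×
  ((B : Set) → B → (v : List B) → length v ≡ length u →
     (∀ p → p ∈ S → IsPalindrome (sub v p)) →
     Σ (Bool → B) λ c → map c u ≡ v)

-- μ(u) ≥ n : no set S ⊆ 𝒮(|u|) of cardinality < n palindromically generates u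
-- (sets represented as duplicate-free lists; cardinality = length)
MuAtLeast : List Bool → ℕ → Set₁
MuAtLeast u n =
  (S : List (ℕ × ℕ)) → Unique S → All (InS (length u)) S → length S < n →
  ¬ PalGenerates S u

-- The Thue–Morse word rigidly controls its long palindromes: from t(2n) = t(n),
-- t(2n+1) = ¬t(n), and the absence of factors aaa and of palindromes of length 5,
-- a palindrome t[a, a + L) with L ≥ 2^(e+3) has 2a + L divisible by 2^(e+2) (halve the
-- positions and induct on e).
--
-- Let S be fewer than K intervals of the prefix of length 2^((K+3)K). Some band
-- (scale i, scale (i+1)) with scale i = 2^((K+3)i) contains no length of S. Put T = scale i
-- and N = 2^(e+2) with 2^(e+3) = scale (i+1), and for q < K mark the positions y with
-- y mod N ∈ {r, N − 1 − r}, r = (2q + 2)T. Long intervals of S are centred at multiples of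
-- N, so the marking of every q is symmetric on them; a short interval has length ≤ T and,
-- the marked residues being ≥ 2T apart, meets the marks of at most one q. So some q
-- meets no short interval, and its marking satisfies all the palindromic constraints of S.
-- It is not a letter-to-letter image of the prefix, since positions 0 and 1 carry both
-- letters but are unmarked while position r is marked. Hence μ ≥ K.

module Submission where

open import Defs
open import Data.Bool using (Bool; true; false; _xor_; not)
open import Data.Bool.Properties using (not-injective; not-¬; not-involutive; not-distribˡ-xor; not-distribʳ-xor)
open import Data.Empty using (⊥; ⊥-elim)
open import Data.List using (List; []; _∷_; length; upTo; applyUpTo; applyDownFrom; drop; take; reverse; map; filter)
open import Data.List.Properties
  using (∷-injectiveˡ; ∷-injectiveʳ; reverse-applyUpTo; map-upTo; map-applyUpTo; length-applyUpTo; length-map; length-upTo; filter-notAll)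
open import Data.List.Membership.Propositional using (_∈_)
open import Data.List.Membership.Propositional.Properties using (∈-filter⁺)
open import Data.List.Relation.Unary.All using (All)
import Data.List.Relation.Unary.All as All
open import Data.List.Relation.Unary.Any using (any?)
import Data.List.Relation.Unary.Any as Any
open import Data.Nat
open import Data.Nat.Properties
open import Data.Nat.DivMod
open import Data.Nat.Divisibility using (_∣_; divides; n∣m*n; *-monoʳ-∣; ∣m+n∣m⇒∣n)
open import Data.Nat.Tactic.RingSolver using (solve; solve-∀)
open import Data.Product using (∃; _,_; _×_; proj₁)
open import Data.Sum using (_⊎_; inj₁; inj₂)
open import Function using (_∘_; _∋_)
open import Function.Bundles using (mk⇔)
open import Relation.Binary.Definitions using (tri<; tri≈; tri>)
open import Relation.Binary.PropositionalEquality
open import Relation.Nullary using (¬_; Dec; does; yes; no; contradiction; ¬?)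
open import Relation.Nullary.Decidable using (_⊎-dec_; _×-dec_; dec-true; dec-false; does-⇔)

even-or-odd : ∀ n → ∃ λ k → n ≡ k + k ⊎ n ≡ suc (k + k)
even-or-odd zero    = 0 , inj₁ refl
even-or-odd (suc n) with even-or-odd n
... | k , inj₁ refl = k , inj₂ refl
... | k , inj₂ refl = suc k , inj₁ (cong suc (sym (+-suc k k)))

∃-half : ∀ a → ∃ λ k → k + k ≤ a × a ≤ suc (k + k)
∃-half a with even-or-odd a
... | k , inj₁ refl = k , ≤-refl , n≤1+n (k + k)
... | k , inj₂ refl = k , n≤1+n (k + k) , ≤-refl

double-≤⇒≤ : ∀ {x y} → x + x ≤ suc (y + y) → x ≤ y
double-≤⇒≤ {x} {y} 2x≤2y+1 with x ≤? y
... | yes x≤y = x≤y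
... | no  x≰y = contradiction 2x≤2y+1 (<⇒≱ (begin-strict
  suc (y + y)   <⟨ s≤s (≤-reflexive (sym (+-suc y y))) ⟩
  suc y + suc y ≤⟨ +-mono-≤ (≰⇒> x≰y) (≰⇒> x≰y) ⟩
  x + x         ∎))
  where open ≤-Reasoning

halve-≤ : ∀ {x y} → x + x ≤ y + y → x ≤ y
halve-≤ 2x≤2y = double-≤⇒≤ (m≤n⇒m≤1+n 2x≤2y)

+-double-injective : ∀ {x y} → x + x ≡ y + y → x ≡ y
+-double-injective eq = ≤-antisym (halve-≤ (≤-reflexive eq)) (halve-≤ (≤-reflexive (sym eq)))

m*n+r≡o*n⇒m≡o : ∀ {m n o r} → m * n + r ≡ o * n → r < n → m ≡ o
m*n+r≡o*n⇒m≡o {m} {n} {o} {r} eq r<n = *-cancelʳ-≡ m o n (begin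
  m * n       ≡⟨ +-identityʳ (m * n) ⟨
  m * n + 0   ≡⟨ cong (m * n +_) r≡0 ⟨
  m * n + r   ≡⟨ eq ⟩
  o * n       ∎)
  where
  open ≡-Reasoning
  instance
    n≢0 : NonZero n
    n≢0 = >-nonZero (≤-<-trans z≤n r<n)
  r≡0 : r ≡ 0
  r≡0 = begin
    r               ≡⟨ m<n⇒m%n≡m r<n ⟨
    r % n           ≡⟨ [m+kn]%n≡m%n r m n ⟨
    (r + m * n) % n ≡⟨ cong (_% n) (trans (+-comm r (m * n)) eq) ⟩
    (o * n) % n     ≡⟨ m*n%n≡0 o n ⟩
    0               ∎

multiple-below-double : ∀ {n z} → 0 < z → z < n + n → n ∣ z → z ≡ n
multiple-below-double ()  _        (divides zero          refl)
multiple-below-double {n} _ _      (divides (suc zero)    refl) = +-identityʳ n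
multiple-below-double {n} _ z<2n   (divides (suc (suc k)) refl) =
  contradiction (+-monoʳ-≤ n (m≤m+n n (k * n))) (<⇒≱ z<2n)

complementary-residues : ∀ {n} .{{_ : NonZero n}} x y → n ∣ suc (x + y) → suc (x % n + y % n) ≡ n
complementary-residues {n} x y n∣x+y+1 =
  multiple-below-double z<s bound (∣m+n∣m⇒∣n (subst (n ∣_) split n∣x+y+1) (n∣m*n (x / n + y / n)))
  where
  open ≡-Reasoning
  regroup : ∀ a b c d k → suc ((a + c * k) + (b + d * k)) ≡ (c + d) * k + suc (a + b)
  regroup = solve-∀
  split : suc (x + y) ≡ (x / n + y / n) * n + suc (x % n + y % n)
  split = begin
    suc (x + y)                                   ≡⟨ cong₂ (λ a b → suc (a + b)) (m≡m%n+[m/n]*n x n) (m≡m%n+[m/n]*n y n) ⟩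
    suc ((x % n + x / n * n) + (y % n + y / n * n)) ≡⟨ regroup (x % n) (y % n) (x / n) (y / n) n ⟩
    (x / n + y / n) * n + suc (x % n + y % n)     ∎
  bound : suc (x % n + y % n) < n + n
  bound = subst (_≤ n + n) (cong suc (+-suc (x % n) (y % n))) (+-mono-≤ (m%n<n x n) (m%n<n y n))

%-+-small : ∀ {n} .{{_ : NonZero n}} y δ → y % n + δ < n → (y + δ) % n ≡ y % n + δ
%-+-small {n} y δ small = begin
  (y + δ) % n               ≡⟨ %-distribˡ-+ y δ n ⟩
  (y % n + δ % n) % n       ≡⟨ cong (λ z → (y % n + z) % n) (m<n⇒m%n≡m (≤-<-trans (m≤n+m δ (y % n)) small)) ⟩
  (y % n + δ) % n           ≡⟨ m<n⇒m%n≡m small ⟩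
  y % n + δ                 ∎
  where open ≡-Reasoning

n<2^n : ∀ n → n < 2 ^ n
n<2^n zero    = s≤s z≤n
n<2^n (suc n) = begin-strict
  suc n              <⟨ s≤s (n<2^n n) ⟩
  suc (2 ^ n)        ≤⟨ +-monoˡ-≤ (2 ^ n) (m^n>0 2 n) ⟩
  2 ^ n + 2 ^ n      ≡⟨ cong (2 ^ n +_) (+-identityʳ (2 ^ n)) ⟨
  2 ^ suc n          ∎
  where open ≤-Reasoning

-- The Thue–Morse word

[1+n]/2≤n : ∀ n → suc n / 2 ≤ n
[1+n]/2≤n n = ≤-pred (m/n<m (suc n) 2 (s≤s (s≤s z≤n)))

tmAux-zero : ∀ f → tmAux f 0 ≡ false
tmAux-zero zero    = refl
tmAux-zero (suc f) = tmAux-zero f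

tmAux-fuel : ∀ f g n → n ≤ f → n ≤ g → tmAux f n ≡ tmAux g n
tmAux-fuel f       g       zero    _         _         = trans (tmAux-zero f) (sym (tmAux-zero g))
tmAux-fuel (suc f) (suc g) (suc n) (s≤s n≤f) (s≤s n≤g) =
  cong (does ((suc n % 2) ≟ 1) xor_)
    (tmAux-fuel f g (suc n / 2) (≤-trans ([1+n]/2≤n n) n≤f) (≤-trans ([1+n]/2≤n n) n≤g))

tm-unfold : ∀ n → tm n ≡ does ((n % 2) ≟ 1) xor tm (n / 2)
tm-unfold zero    = refl
tm-unfold (suc n) =
  cong (does ((suc n % 2) ≟ 1) xor_) (tmAux-fuel n (suc n / 2) (suc n / 2) ([1+n]/2≤n n) ≤-refl)

n+n≡n*2 : ∀ n → n + n ≡ n * 2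
n+n≡n*2 n = trans (cong (n +_) (sym (+-identityʳ n))) (*-comm 2 n)

tm-double : ∀ n → tm (n + n) ≡ tm n
tm-double n = begin
  tm (n + n)                                   ≡⟨ cong tm (n+n≡n*2 n) ⟩
  tm (n * 2)                                   ≡⟨ tm-unfold (n * 2) ⟩
  does ((n * 2) % 2 ≟ 1) xor tm (n * 2 / 2)    ≡⟨ cong₂ (λ r q → does (r ≟ 1) xor tm q) (m*n%n≡0 n 2) (m*n/n≡m n 2) ⟩
  tm n                                         ∎
  where open ≡-Reasoning

tm-double+1 : ∀ n → tm (suc (n + n)) ≡ not (tm n)
tm-double+1 n = begin
  tm (1 + n + n)                                     ≡⟨ cong (tm ∘ suc) (n+n≡n*2 n) ⟩
  tm (1 + n * 2)                                     ≡⟨ tm-unfold (1 + n * 2) ⟩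
  does ((1 + n * 2) % 2 ≟ 1) xor tm ((1 + n * 2) / 2) ≡⟨ cong₂ (λ r q → does (r ≟ 1) xor tm q) ([m+kn]%n≡m%n 1 n 2) half ⟩
  not (tm n)                                         ∎
  where
  open ≡-Reasoning
  half : (1 + n * 2) / 2 ≡ n
  half = trans (+-distrib-/-∣ʳ 1 {d = 2} (n∣m*n n)) (m*n/n≡m n 2)

tm-even-at : ∀ n k → n ≡ k + k → tm n ≡ tm k
tm-even-at n k refl = tm-double k

tm-odd-at : ∀ n k → n ≡ suc (k + k) → tm n ≡ not (tm k)
tm-odd-at n k refl = tm-double+1 k

tm-block-distinct : ∀ n k → n ≡ k + k → tm n ≢ tm (suc n)
tm-block-distinct n k n≡2k eq =
  not-¬ refl (trans (sym (tm-even-at n k n≡2k)) (trans eq (tm-odd-at (suc n) k (cong suc n≡2k))))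

tm-no-triple : ∀ c → tm c ≡ tm (1 + c) → tm (1 + c) ≡ tm (2 + c) → ⊥
tm-no-triple c p q with even-or-odd c
... | k , inj₁ c≡2k  = tm-block-distinct c k c≡2k p
... | k , inj₂ c≡2k+1 = tm-block-distinct (1 + c) (1 + k) (trans (cong suc c≡2k+1) (cong suc (sym (+-suc k k)))) q

tm-no-palindrome₅ : ∀ q → tm (1 + q) ≡ tm (3 + q) → tm q ≡ tm (4 + q) → ⊥
tm-no-palindrome₅ q p r with even-or-odd q
... | k , inj₁ refl = tm-no-triple k k≈k+1 (trans (sym k≈k+1) k≈k+2)
  where
  k≈k+1 : tm k ≡ tm (1 + k)
  k≈k+1 = not-injective (begin
    not (tm k)         ≡⟨ tm-odd-at (1 + (k + k)) k refl ⟨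
    tm (1 + (k + k))   ≡⟨ p ⟩
    tm (3 + (k + k))   ≡⟨ tm-odd-at (3 + (k + k)) (1 + k) (solve (k ∷ [])) ⟩
    not (tm (1 + k))   ∎)
    where open ≡-Reasoning
  k≈k+2 : tm k ≡ tm (2 + k)
  k≈k+2 = trans (sym (tm-double k)) (trans r (tm-even-at (4 + (k + k)) (2 + k) (solve (k ∷ []))))
... | k , inj₂ refl = tm-no-triple k (trans k≈k+2 (sym k+1≈k+2)) k+1≈k+2
  where
  k+1≈k+2 : tm (1 + k) ≡ tm (2 + k)
  k+1≈k+2 = begin
    tm (1 + k)         ≡⟨ tm-even-at (2 + (k + k)) (1 + k) (solve (k ∷ [])) ⟨
    tm (2 + (k + k))   ≡⟨ p ⟩
    tm (4 + (k + k))   ≡⟨ tm-even-at (4 + (k + k)) (2 + k) (solve (k ∷ [])) ⟩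
    tm (2 + k)         ∎
    where open ≡-Reasoning
  k≈k+2 : tm k ≡ tm (2 + k)
  k≈k+2 = not-injective (trans (sym (tm-double+1 k)) (trans r (tm-odd-at (5 + (k + k)) (2 + k) (solve (k ∷ [])))))

-- Mirrored factors

-- On the window [a, σ − a), the reflection x ↦ σ − 1 − x preserves tm (b = false)
-- or complements it (b = true).
record Mirrored (b : Bool) (a σ : ℕ) : Set where
  constructor mirrored
  field reflect : ∀ x y → a ≤ x → a ≤ y → suc (x + y) ≡ σ → tm x ≡ b xor tm y
open Mirrored

mirrored-odd-⊥ : ∀ {b a} k → 2 + a ≤ k → ¬ Mirrored b a (suc (k + k))
mirrored-odd-⊥ {true}  (suc (suc c)) (s≤s (s≤s a≤c)) (mirrored M) =
  not-¬ refl (M (2 + c) (2 + c) (≤-trans a≤c (m≤n+m c 2)) (≤-trans a≤c (m≤n+m c 2)) refl)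
mirrored-odd-⊥ {false} (suc (suc c)) (s≤s (s≤s a≤c)) (mirrored M) =
  tm-no-palindrome₅ c
    (M (1 + c) (3 + c) (≤-trans a≤c (m≤n+m c 1)) (≤-trans a≤c (m≤n+m c 3)) (solve (c ∷ [])))
    (M c (4 + c) a≤c (≤-trans a≤c (m≤n+m c 4)) (solve (c ∷ [])))

mirrored-2mod4-⊥ : ∀ {b a} j → 3 + a ≤ j + j → ¬ Mirrored b a (suc (j + j) + suc (j + j))
mirrored-2mod4-⊥ zero ()
mirrored-2mod4-⊥ (suc zero) (s≤s (s≤s ()))
mirrored-2mod4-⊥ {b} {a} (suc (suc c)) (s≤s (s≤s 1+a≤2c+2)) = go b
  where
  a≤2c+1 : a ≤ suc (c + c)
  a≤2c+1 = ≤-pred (subst (suc a ≤_) (trans (+-suc c (suc c)) (cong suc (+-suc c c))) 1+a≤2c+2)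
  above : ∀ n → a ≤ n + suc (c + c)
  above n = ≤-trans a≤2c+1 (m≤n+m _ n)
  go : ∀ b → ¬ Mirrored b a (suc ((2 + c) + (2 + c)) + suc ((2 + c) + (2 + c)))
  go false (mirrored M) = tm-block-distinct (4 + (c + c)) (2 + c) (solve (c ∷ []))
    (M (4 + (c + c)) (5 + (c + c)) (above 3) (above 4) (solve (c ∷ [])))
  go true  (mirrored M) = tm-no-palindrome₅ c
    (not-injective (begin
      not (tm (1 + c))        ≡⟨ tm-odd-at (3 + (c + c)) (1 + c) (solve (c ∷ [])) ⟨
      tm (3 + (c + c))        ≡⟨ M (3 + (c + c)) (6 + (c + c)) (above 2) (above 5) (solve (c ∷ [])) ⟩
      not (tm (6 + (c + c)))  ≡⟨ cong not (tm-even-at (6 + (c + c)) (3 + c) (solve (c ∷ []))) ⟩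
      not (tm (3 + c))        ∎))
    (not-injective (begin
      not (tm c)              ≡⟨ tm-double+1 c ⟨
      tm (1 + (c + c))        ≡⟨ M (1 + (c + c)) (8 + (c + c)) (above 0) (above 7) (solve (c ∷ [])) ⟩
      not (tm (8 + (c + c)))  ≡⟨ cong not (tm-even-at (8 + (c + c)) (4 + c) (solve (c ∷ []))) ⟩
      not (tm (4 + c))        ∎))
    where open ≡-Reasoning

mirrored-4∣ : ∀ {b a σ} → Mirrored b a σ → a + a + 8 ≤ σ → 4 ∣ σ
mirrored-4∣ {b} {a} {σ} M big with even-or-odd σ
... | k , inj₂ refl = contradiction M (mirrored-odd-⊥ k (≤-trans (m≤n+m (2 + a) 2) (double-≤⇒≤ big′)))
  where
  big′ : (4 + a) + (4 + a) ≤ suc (k + k)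
  big′ = ≤-trans (≤-reflexive ((4 + a) + (4 + a) ≡ a + a + 8 ∋ solve (a ∷ []))) big
... | k , inj₁ refl with even-or-odd k
...   | j , inj₁ refl = divides j (solve (j ∷ []))
...   | j , inj₂ refl = contradiction M (mirrored-2mod4-⊥ j (≤-pred (halve-≤ big′)))
  where
  big′ : (4 + a) + (4 + a) ≤ suc (j + j) + suc (j + j)
  big′ = ≤-trans (≤-reflexive ((4 + a) + (4 + a) ≡ a + a + 8 ∋ solve (a ∷ []))) big

mirrored-halve : ∀ {b a k d} → a + a < (d + d) + (d + d) → k + k ≤ a → a ≤ suc (k + k) →
                 Mirrored b a ((d + d) + (d + d)) → Mirrored (not b) k (d + d)
mirrored-halve {b} {a} {k} {d} small lo hi (mirrored M) .reflect g h k≤g k≤h g+h+1≡2d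
  with a ≤? g + g | a ≤? h + h
... | yes a≤2g | _ = begin
  tm g                     ≡⟨ tm-double g ⟨
  tm (g + g)               ≡⟨ M (g + g) (suc (h + h)) a≤2g (≤-trans hi (s≤s (+-mono-≤ k≤h k≤h))) 2g+2h+1+1≡4d ⟩
  b xor tm (suc (h + h))   ≡⟨ cong (b xor_) (tm-double+1 h) ⟩
  b xor not (tm h)         ≡⟨ not-distribʳ-xor b (tm h) ⟨
  not (b xor tm h)         ≡⟨ not-distribˡ-xor b (tm h) ⟩
  not b xor tm h           ∎
  where
  open ≡-Reasoning
  2g+2h+1+1≡4d : suc ((g + g) + suc (h + h)) ≡ (d + d) + (d + d)
  2g+2h+1+1≡4d = begin
    suc ((g + g) + suc (h + h)) ≡⟨ solve (g ∷ h ∷ []) ⟩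
    suc (g + h) + suc (g + h)   ≡⟨ cong₂ _+_ g+h+1≡2d g+h+1≡2d ⟩
    (d + d) + (d + d)           ∎
... | no _ | yes a≤2h = begin
  tm g                     ≡⟨ not-involutive (tm g) ⟨
  not (not (tm g))         ≡⟨ cong not (tm-double+1 g) ⟨
  not (tm (suc (g + g)))   ≡⟨ cong not (M (suc (g + g)) (h + h) (≤-trans hi (s≤s (+-mono-≤ k≤g k≤g))) a≤2h 2g+1+2h+1≡4d) ⟩
  not (b xor tm (h + h))   ≡⟨ cong (λ t → not (b xor t)) (tm-double h) ⟩
  not (b xor tm h)         ≡⟨ not-distribˡ-xor b (tm h) ⟩
  not b xor tm h           ∎
  where
  open ≡-Reasoning
  2g+1+2h+1≡4d : suc (suc (g + g) + (h + h)) ≡ (d + d) + (d + d)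
  2g+1+2h+1≡4d = begin
    suc (suc (g + g) + (h + h)) ≡⟨ solve (g ∷ h ∷ []) ⟩
    suc (g + h) + suc (g + h)   ≡⟨ cong₂ _+_ g+h+1≡2d g+h+1≡2d ⟩
    (d + d) + (d + d)           ∎
... | no 2g<a | no 2h<a = contradiction small (≤⇒≯ (begin
  (d + d) + (d + d)         ≡⟨ cong₂ _+_ g+h+1≡2d g+h+1≡2d ⟨
  suc (g + h) + suc (g + h) ≡⟨ solve (g ∷ h ∷ []) ⟩
  suc (g + g) + suc (h + h) ≤⟨ +-mono-≤ (≰⇒> 2g<a) (≰⇒> 2h<a) ⟩
  a + a                     ∎))
  where open ≤-Reasoning

mirrored-centre-divisible : ∀ e {b a σ} → Mirrored b a σ → a + a + 2 ^ (3 + e) ≤ σ → 2 ^ (2 + e) ∣ σ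
mirrored-centre-divisible zero    M big = mirrored-4∣ M big
mirrored-centre-divisible (suc e) {b} {a} M big
  with mirrored-4∣ M (≤-trans (+-monoʳ-≤ (a + a) (^-monoʳ-≤ 2 (m≤m+n 3 (suc e)))) big)
... | divides d refl with ∃-half a
... | k , lo , hi = subst (2 ^ (3 + e) ∣_) (2 * (d + d) ≡ d * 4 ∋ solve (d ∷ []))
                      (*-monoʳ-∣ 2 (mirrored-centre-divisible e (mirrored-halve {k = k} {d = d} small lo hi M′) big′))
  where
  open ≤-Reasoning
  X = 2 ^ (3 + e)
  4d≡2d+2d : d * 4 ≡ (d + d) + (d + d)
  4d≡2d+2d = solve (d ∷ [])
  M′ : Mirrored b a ((d + d) + (d + d))
  M′ = subst (Mirrored b a) 4d≡2d+2d M
  small : a + a < (d + d) + (d + d)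
  small = begin-strict
    a + a                 <⟨ m<m+n (a + a) (m^n>0 2 (3 + suc e)) ⟩
    a + a + 2 ^ (3 + suc e) ≤⟨ big ⟩
    d * 4                 ≡⟨ 4d≡2d+2d ⟩
    (d + d) + (d + d)     ∎
  regroup : ∀ k x → (k + k + x) + (k + k + x) ≡ (k + k) + (k + k) + 2 * x
  regroup = solve-∀
  big′ : k + k + X ≤ d + d
  big′ = halve-≤ (begin
    (k + k + X) + (k + k + X)    ≡⟨ regroup k X ⟩
    (k + k) + (k + k) + 2 * X    ≤⟨ +-monoˡ-≤ (2 * X) (+-mono-≤ lo lo) ⟩
    a + a + 2 * X                ≤⟨ big ⟩
    d * 4                        ≡⟨ 4d≡2d+2d ⟩
    (d + d) + (d + d)            ∎)

-- Palindromic factors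

module _ {A : Set} where

  drop-applyUpTo : ∀ (f : ℕ → A) d m → drop d (applyUpTo f m) ≡ applyUpTo (λ x → f (d + x)) (m ∸ d)
  drop-applyUpTo f zero    m       = refl
  drop-applyUpTo f (suc d) zero    = refl
  drop-applyUpTo f (suc d) (suc m) = drop-applyUpTo (f ∘ suc) d m

  take-applyUpTo : ∀ (f : ℕ → A) {l m} → l ≤ m → take l (applyUpTo f m) ≡ applyUpTo f l
  take-applyUpTo f z≤n       = refl
  take-applyUpTo f (s≤s l≤m) = cong (f 0 ∷_) (take-applyUpTo (f ∘ suc) l≤m)

  applyDownFrom≡applyUpTo : ∀ (f : ℕ → A) L → applyDownFrom f L ≡ applyUpTo (λ x → f (L ∸ suc x)) L
  applyDownFrom≡applyUpTo f zero    = refl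
  applyDownFrom≡applyUpTo f (suc L) = cong (f L ∷_) (applyDownFrom≡applyUpTo f L)

  applyUpTo-cong : ∀ {f g : ℕ → A} L → (∀ {x} → x < L → f x ≡ g x) → applyUpTo f L ≡ applyUpTo g L
  applyUpTo-cong zero    f≈g = refl
  applyUpTo-cong (suc L) f≈g = cong₂ _∷_ (f≈g z<s) (applyUpTo-cong L (f≈g ∘ s<s))

  applyUpTo-injective : ∀ {f g : ℕ → A} L → applyUpTo f L ≡ applyUpTo g L → ∀ {x} → x < L → f x ≡ g x
  applyUpTo-injective (suc L) eq {zero}  _         = ∷-injectiveˡ eq
  applyUpTo-injective (suc L) eq {suc x} (s<s x<L) = applyUpTo-injective L (∷-injectiveʳ eq) x<L

  applyUpTo-palindrome⁺ : ∀ (f : ℕ → A) L → (∀ {x} → x < L → f (L ∸ suc x) ≡ f x) →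
                          IsPalindrome (applyUpTo f L)
  applyUpTo-palindrome⁺ f L sym-f = begin
    reverse (applyUpTo f L)               ≡⟨ reverse-applyUpTo f L ⟩
    applyDownFrom f L                     ≡⟨ applyDownFrom≡applyUpTo f L ⟩
    applyUpTo (λ x → f (L ∸ suc x)) L     ≡⟨ applyUpTo-cong L sym-f ⟩
    applyUpTo f L                         ∎
    where open ≡-Reasoning

  applyUpTo-palindrome⁻ : ∀ (f : ℕ → A) L → IsPalindrome (applyUpTo f L) →
                          ∀ {x} → x < L → f (L ∸ suc x) ≡ f x
  applyUpTo-palindrome⁻ f L pal = applyUpTo-injective L (begin
    applyUpTo (λ x → f (L ∸ suc x)) L     ≡⟨ applyDownFrom≡applyUpTo f L ⟨
    applyDownFrom f L                     ≡⟨ reverse-applyUpTo f L ⟨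
    reverse (applyUpTo f L)               ≡⟨ pal ⟩
    applyUpTo f L                         ∎)
    where open ≡-Reasoning

-- The 0-indexed start and the length of the factor u[i, j].
start width : ℕ × ℕ → ℕ
start (i , j) = i ∸ 1
width (i , j) = suc j ∸ i

sub-applyUpTo : ∀ {A : Set} (f : ℕ → A) {m} p → InS m p →
                sub (applyUpTo f m) p ≡ applyUpTo (λ x → f (start p + x)) (width p)
sub-applyUpTo f {m} (suc i , j) (_ , _ , j≤m) = begin
  take (j ∸ i) (drop i (applyUpTo f m))          ≡⟨ cong (take (j ∸ i)) (drop-applyUpTo f i m) ⟩
  take (j ∸ i) (applyUpTo (λ x → f (i + x)) (m ∸ i)) ≡⟨ take-applyUpTo _ (∸-monoˡ-≤ i j≤m) ⟩
  applyUpTo (λ x → f (i + x)) (j ∸ i)           ∎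
  where open ≡-Reasoning

tmFactor-prefix : ∀ m → tmFactor 0 m ≡ applyUpTo tm m
tmFactor-prefix m = map-upTo tm m

length-tmFactor : ∀ k m → length (tmFactor k m) ≡ m
length-tmFactor k m = trans (length-map _ (upTo m)) (length-upTo m)

palindrome⇒mirrored : ∀ a L → (∀ {x} → x < L → tm (a + (L ∸ suc x)) ≡ tm (a + x)) →
                      Mirrored false a (a + a + L)
palindrome⇒mirrored a L sym-tm .reflect X Y a≤X a≤Y X+Y+1≡σ
  with m≤n⇒∃[o]m+o≡n a≤X | m≤n⇒∃[o]m+o≡n a≤Y
... | x , refl | y , refl = begin
  tm (a + x)               ≡⟨ sym-tm x<L ⟨
  tm (a + (L ∸ suc x))     ≡⟨ cong (λ z → tm (a + z)) L-x-1≡y ⟩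
  tm (a + y)               ∎
  where
  open ≡-Reasoning
  x+y+1≡L : suc (x + y) ≡ L
  x+y+1≡L = +-cancelˡ-≡ (a + a) _ _ (begin
    a + a + suc (x + y)       ≡⟨ solve (a ∷ x ∷ y ∷ []) ⟩
    suc ((a + x) + (a + y))   ≡⟨ X+Y+1≡σ ⟩
    a + a + L                 ∎)
  x<L : x < L
  x<L = subst (x <_) x+y+1≡L (s≤s (m≤m+n x y))
  L-x-1≡y : L ∸ suc x ≡ y
  L-x-1≡y = trans (cong (_∸ suc x) (sym x+y+1≡L)) (m+n∸m≡n x y)

tm-palindrome-centre-divisible : ∀ e {m} p → InS m p → IsPalindrome (sub (tmFactor 0 m) p) →
                                 2 ^ (3 + e) ≤ width p → 2 ^ (2 + e) ∣ start p + start p + width p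
tm-palindrome-centre-divisible e {m} p p∈S pal long =
  mirrored-centre-divisible e
    (palindrome⇒mirrored a L (applyUpTo-palindrome⁻ (λ x → tm (a + x)) L pal′))
    (+-monoʳ-≤ (a + a) long)
  where
  a = start p
  L = width p
  pal′ : IsPalindrome (applyUpTo (λ x → tm (a + x)) L)
  pal′ = subst IsPalindrome (trans (cong (λ u → sub u p) (tmFactor-prefix m)) (sub-applyUpTo tm p p∈S)) pal

-- Pigeonhole

module _ {X : Set} {R : X → ℕ → Set} (R? : ∀ x q → Dec (R x q))
         (R-functional : ∀ x {q q′} → R x q → R x q′ → q ≡ q′) where

  ∃-unrelated : ∀ K (xs : List X) → length xs < K → ∃ λ q → q < K × (∀ {x} → x ∈ xs → ¬ R x q)
  ∃-unrelated (suc K) xs |xs|≤K with any? (λ x → R? x K) xs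
  ... | no none = K , ≤-refl , λ x∈xs xRK → none (Any.map (λ { refl → xRK }) x∈xs)
  ... | yes some with ∃-unrelated K (filter (λ x → ¬? (R? x K)) xs) (<-≤-trans fewer (≤-pred |xs|≤K))
    where
    fewer : length (filter (λ x → ¬? (R? x K)) xs) < length xs
    fewer = filter-notAll (λ x → ¬? (R? x K)) xs (Any.map (λ xRK ¬xRK → ¬xRK xRK) some)
  ... | q , q<K , unrelated = q , m≤n⇒m≤1+n q<K , λ {x} → unrelated′ (R? x K)
    where
    unrelated′ : ∀ {x} → Dec (R x K) → x ∈ xs → ¬ R x q
    unrelated′ (yes xRK) _    xRq = <-irrefl (R-functional _ xRq xRK) q<K
    unrelated′ (no ¬xRK) x∈xs xRq = unrelated (∈-filter⁺ (λ x → ¬? (R? x K)) x∈xs ¬xRK) xRq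

-- Colourings

module Colouring (K T N : ℕ) .{{_ : NonZero N}} (T≥1 : 1 ≤ T) (spread : 4 * suc K * T ≤ N) where

  r : ℕ → ℕ
  r q = (suc q + suc q) * T

  IsMarkResidue : ℕ → ℕ → Set
  IsMarkResidue q v = v ≡ r q ⊎ suc (v + r q) ≡ N

  Marked : ℕ → ℕ → Set
  Marked q y = IsMarkResidue q (y % N)

  Marked? : ∀ q y → Dec (Marked q y)
  Marked? q y = (y % N ≟ r q) ⊎-dec (suc (y % N + r q) ≟ N)

  2T≤r : ∀ q → 2 * T ≤ r q
  2T≤r q = *-monoˡ-≤ T (s≤s (≤-trans (s≤s z≤n) (m≤n+m (suc q) q)))

  residues-sum< : ∀ {q₁ q₂} → q₁ < K → q₂ < K → r q₁ + r q₂ + T < N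
  residues-sum< {q₁} {q₂} q₁<K q₂<K = begin-strict
    r q₁ + r q₂ + T                       ≤⟨ +-monoˡ-≤ T (+-mono-≤ (r≤ q₁<K) (r≤ q₂<K)) ⟩
    (K + K) * T + (K + K) * T + T         <⟨ m<m+n _ (≤-trans (s≤s z≤n) (*-monoʳ-≤ 3 T≥1)) ⟩
    (K + K) * T + (K + K) * T + T + 3 * T ≡⟨ regroup K T ⟩
    4 * suc K * T                         ≤⟨ spread ⟩
    N                                     ∎
    where
    open ≤-Reasoning
    r≤ : ∀ {q} → q < K → r q ≤ (K + K) * T
    r≤ q<K = *-monoˡ-≤ T (+-mono-≤ q<K q<K)
    regroup : ∀ k t → (k + k) * t + (k + k) * t + t + 3 * t ≡ 4 * suc k * t
    regroup = solve-∀

  r<N : ∀ {q} → q < K → r q < N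
  r<N {q} q<K = ≤-<-trans (≤-trans (m≤m+n (r q) (r q)) (m≤m+n _ T)) (residues-sum< q<K q<K)

  marked-reflect : ∀ {q x y} → suc (x % N + y % N) ≡ N → Marked q x → Marked q y
  marked-reflect {q} {x} {y} x+y+1≡N (inj₁ x≡r) = inj₂ (begin
    suc (y % N + r q)    ≡⟨ cong suc (+-comm (y % N) (r q)) ⟩
    suc (r q + y % N)    ≡⟨ cong (λ v → suc (v + y % N)) x≡r ⟨
    suc (x % N + y % N)  ≡⟨ x+y+1≡N ⟩
    N                    ∎)
    where open ≡-Reasoning
  marked-reflect {q} {x} x+y+1≡N (inj₂ x+r+1≡N) =
    inj₁ (sym (+-cancelˡ-≡ (x % N) _ _ (suc-injective (trans x+r+1≡N (sym x+y+1≡N)))))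

  r-spacing : ∀ {q₁ q₂ δ} → r q₁ + δ ≡ r q₂ → δ < T → q₁ ≡ q₂
  r-spacing eq δ<T = suc-injective (+-double-injective (m*n+r≡o*n⇒m≡o eq δ<T))

  marked-window : ∀ {q₁ q₂ y δ} → q₁ < K → q₂ < K → δ < T → Marked q₁ y → Marked q₂ (y + δ) → q₁ ≡ q₂
  marked-window {q₁} {q₂} {y} {δ} q₁<K q₂<K δ<T m₁ m₂ =
    residues-close m₁ (subst (IsMarkResidue q₂) (%-+-small y δ (no-wrap m₁)) m₂)
    where
    open ≤-Reasoning
    v = y % N
    no-wrap : IsMarkResidue q₁ v → v + δ < N
    no-wrap (inj₁ v≡r₁) = begin-strict
      v + δ            ≡⟨ cong (_+ δ) v≡r₁ ⟩
      r q₁ + δ         <⟨ +-monoʳ-< (r q₁) δ<T ⟩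
      r q₁ + T         ≤⟨ +-monoˡ-≤ T (m≤m+n (r q₁) (r q₁)) ⟩
      r q₁ + r q₁ + T  <⟨ residues-sum< q₁<K q₁<K ⟩
      N                ∎
    no-wrap (inj₂ v+r₁+1≡N) = begin-strict
      v + δ            <⟨ +-monoʳ-< v (<-≤-trans δ<T (≤-trans (m≤m+n T (T + 0)) (2T≤r q₁))) ⟩
      v + r q₁         <⟨ n<1+n _ ⟩
      suc (v + r q₁)   ≡⟨ v+r₁+1≡N ⟩
      N                ∎
    shuffle : ∀ a b d → suc (a + d + b) ≡ a + b + suc d
    shuffle = solve-∀
    residues-close : IsMarkResidue q₁ v → IsMarkResidue q₂ (v + δ) → q₁ ≡ q₂
    residues-close (inj₁ v≡r₁) (inj₁ v+δ≡r₂) = r-spacing (trans (cong (_+ δ) (sym v≡r₁)) v+δ≡r₂) δ<T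
    residues-close (inj₂ v+r₁+1≡N) (inj₂ v+δ+r₂+1≡N) = sym (r-spacing (+-cancelˡ-≡ v _ _ (suc-injective (begin-equality
      suc (v + (r q₂ + δ))  ≡⟨ cong (λ z → suc (v + z)) (+-comm (r q₂) δ) ⟩
      suc (v + (δ + r q₂))  ≡⟨ cong suc (+-assoc v δ (r q₂)) ⟨
      suc (v + δ + r q₂)    ≡⟨ v+δ+r₂+1≡N ⟩
      N                     ≡⟨ v+r₁+1≡N ⟨
      suc (v + r q₁)        ∎))) δ<T)
    residues-close (inj₁ v≡r₁) (inj₂ v+δ+r₂+1≡N) = ⊥-elim (<-irrefl refl (begin-strict
      N                     ≡⟨ v+δ+r₂+1≡N ⟨
      suc (v + δ + r q₂)    ≡⟨ cong (λ z → suc (z + δ + r q₂)) v≡r₁ ⟩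
      suc (r q₁ + δ + r q₂) ≡⟨ shuffle (r q₁) (r q₂) δ ⟩
      r q₁ + r q₂ + suc δ   ≤⟨ +-monoʳ-≤ (r q₁ + r q₂) δ<T ⟩
      r q₁ + r q₂ + T       <⟨ residues-sum< q₁<K q₂<K ⟩
      N                     ∎))
    residues-close (inj₂ v+r₁+1≡N) (inj₁ v+δ≡r₂) = ⊥-elim (<-irrefl refl (begin-strict
      N                     ≡⟨ v+r₁+1≡N ⟨
      suc (v + r q₁)        ≤⟨ s≤s (+-monoˡ-≤ (r q₁) (m≤m+n v δ)) ⟩
      suc (v + δ + r q₁)    ≡⟨ cong (λ z → suc (z + r q₁)) v+δ≡r₂ ⟩
      suc (r q₂ + r q₁)     ≡⟨ +-comm 1 (r q₂ + r q₁) ⟩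
      r q₂ + r q₁ + 1       ≤⟨ +-monoʳ-≤ (r q₂ + r q₁) T≥1 ⟩
      r q₂ + r q₁ + T       <⟨ residues-sum< q₂<K q₁<K ⟩
      N                     ∎))

  unmarked-below-2T : ∀ {q y} → q < K → y < 2 * T → ¬ Marked q y
  unmarked-below-2T {q} {y} q<K y<2T marked = contradiction (subst (IsMarkResidue q) (m<n⇒m%n≡m y<N) marked) unmarked
    where
    y<r : y < r q
    y<r = <-≤-trans y<2T (2T≤r q)
    y<N : y < N
    y<N = <-trans y<r (r<N q<K)
    unmarked : ¬ IsMarkResidue q y
    unmarked (inj₁ y≡r)     = <-irrefl y≡r y<r
    unmarked (inj₂ y+r+1≡N) = <-irrefl y+r+1≡N (begin-strict
      suc (y + r q)    ≤⟨ +-monoˡ-≤ (r q) y<r ⟩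
      r q + r q        ≤⟨ m≤m+n (r q + r q) T ⟩
      r q + r q + T    <⟨ residues-sum< q<K q<K ⟩
      N                ∎)
      where open ≤-Reasoning

  marked-r : ∀ {q} → q < K → Marked q (r q)
  marked-r q<K = inj₁ (m<n⇒m%n≡m (r<N q<K))

  mark : ℕ → ℕ → Bool
  mark q y = does (Marked? q y)

  Hits : ℕ × ℕ → ℕ → Set
  Hits p q = q < K × width p ≤ T × ∃ λ x → x < width p × Marked q (start p + x)

  Hits? : ∀ p q → Dec (Hits p q)
  Hits? p q = (q <? K) ×-dec (width p ≤? T) ×-dec anyUpTo? (λ x → Marked? q (start p + x)) (width p)

  close-marks : ∀ {q q′ a x x′} → q < K → q′ < K → x ≤ x′ → x′ < T →
                Marked q (a + x) → Marked q′ (a + x′) → q ≡ q′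
  close-marks {q′ = q′} {a} {x} q<K q′<K x≤x′ x′<T m m′ with m≤n⇒∃[o]m+o≡n x≤x′
  ... | δ , refl = marked-window q<K q′<K (≤-<-trans (m≤n+m δ x) x′<T) m
                     (subst (Marked q′) (sym (+-assoc a x δ)) m′)

  hits-functional : ∀ p {q q′} → Hits p q → Hits p q′ → q ≡ q′
  hits-functional p (q<K , L≤T , x , x<L , m) (q′<K , _ , x′ , x′<L , m′) with ≤-total x x′
  ... | inj₁ x≤x′ = close-marks q<K q′<K x≤x′ (<-≤-trans x′<L L≤T) m m′
  ... | inj₂ x′≤x = sym (close-marks q′<K q<K x′≤x (<-≤-trans x<L L≤T) m′ m)

  reflect-index< : ∀ {x L} → x < L → L ∸ suc x < L
  reflect-index< {x} {suc L} _ = s≤s (m∸n≤m L x)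

  mark-mirror : ∀ {q} a L → ((∀ {x} → x < L → ¬ Marked q (a + x)) ⊎ N ∣ a + a + L) →
                ∀ {x} → x < L → mark q (a + (L ∸ suc x)) ≡ mark q (a + x)
  mark-mirror {q} a L (inj₁ unmarked) x<L =
    trans (dec-false (Marked? q _) (unmarked (reflect-index< x<L))) (sym (dec-false (Marked? q _) (unmarked x<L)))
  mark-mirror {q} a L (inj₂ N∣σ) {x} x<L =
    does-⇔ (mk⇔ (marked-reflect {q} {X} {Y} complementary)
                (marked-reflect {q} {Y} {X} (trans (cong suc (+-comm (Y % N) (X % N))) complementary)))
           (Marked? q X) (Marked? q Y)
    where
    open ≡-Reasoning
    X = a + (L ∸ suc x)
    Y = a + x
    regroup : ∀ a l x → suc ((a + l) + (a + x)) ≡ a + a + (l + suc x)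
    regroup = solve-∀
    pairing : suc (X + Y) ≡ a + a + L
    pairing = begin
      suc ((a + (L ∸ suc x)) + (a + x))  ≡⟨ regroup a (L ∸ suc x) x ⟩
      a + a + ((L ∸ suc x) + suc x)      ≡⟨ cong (a + a +_) (m∸n+n≡m x<L) ⟩
      a + a + L                          ∎
    complementary : suc (X % N + Y % N) ≡ N
    complementary = complementary-residues X Y (subst (N ∣_) (sym pairing) N∣σ)

  colouring : ℕ → ℕ → List Bool
  colouring q m = applyUpTo (mark q) m

  colouring-palindrome : ∀ {q m} p → InS m p →
                         ((∀ {x} → x < width p → ¬ Marked q (start p + x)) ⊎ N ∣ start p + start p + width p) →
                         IsPalindrome (sub (colouring q m) p)
  colouring-palindrome {q} p p∈ unmarked-or-centred =
    subst IsPalindrome (sym (sub-applyUpTo (mark q) p p∈))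
      (applyUpTo-palindrome⁺ (λ x → mark q (start p + x)) (width p) (mark-mirror {q} (start p) (width p) unmarked-or-centred))

  colouring-not-recolouring : ∀ {q m} → q < K → N ≤ m → (c : Bool → Bool) → map c (tmFactor 0 m) ≢ colouring q m
  colouring-not-recolouring {q} {m} q<K N≤m c eq = false≢true (begin
    false           ≡⟨ c-false (tm (r q)) ⟨
    c (tm (r q))    ≡⟨ pointwise (<-≤-trans (r<N q<K) N≤m) ⟩
    mark q (r q)    ≡⟨ dec-true (Marked? q (r q)) (marked-r q<K) ⟩
    true            ∎)
    where
    open ≡-Reasoning
    false≢true : false ≢ true
    false≢true ()
    pointwise : ∀ {y} → y < m → c (tm y) ≡ mark q y
    pointwise = applyUpTo-injective m (trans (sym (map-applyUpTo tm c m)) (trans (cong (map c) (sym (tmFactor-prefix m))) eq))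
    1<2T : 1 < 2 * T
    1<2T = *-monoʳ-≤ 2 T≥1
    0<2T : 0 < 2 * T
    0<2T = ≤-<-trans z≤n 1<2T
    2T≤m : 2 * T ≤ m
    2T≤m = ≤-trans (2T≤r q) (≤-trans (<⇒≤ (r<N q<K)) N≤m)
    c-false : ∀ b → c b ≡ false
    c-false false = trans (pointwise (<-≤-trans 0<2T 2T≤m)) (dec-false (Marked? q 0) (unmarked-below-2T q<K 0<2T))
    c-false true  = trans (pointwise (<-≤-trans 1<2T 2T≤m)) (dec-false (Marked? q 1) (unmarked-below-2T q<K 1<2T))

  ¬palGenerates : ∀ {m} S → length S < K → All (InS m) S → N ≤ m →
                  (∀ {p} → p ∈ S → width p ≤ T ⊎ N ∣ start p + start p + width p) →
                  ¬ PalGenerates S (tmFactor 0 m)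
  ¬palGenerates {m} S |S|<K S⊆ N≤m short-or-centred (_ , generates)
    with ∃-unrelated {R = Hits} Hits? hits-functional K S |S|<K
  ... | q , q<K , unhit with generates Bool false (colouring q m) same-length colouring-palindromic
    where
    same-length : length (colouring q m) ≡ length (tmFactor 0 m)
    same-length = trans (length-applyUpTo (mark q) m) (sym (length-tmFactor 0 m))
    unmarked-or-centred : ∀ {p} → p ∈ S →
                          (∀ {x} → x < width p → ¬ Marked q (start p + x)) ⊎ N ∣ start p + start p + width p
    unmarked-or-centred {p} p∈S with short-or-centred p∈S
    ... | inj₁ short  = inj₁ λ x<L marked → unhit p∈S (q<K , short , _ , x<L , marked)
    ... | inj₂ centred = inj₂ centred
    colouring-palindromic : ∀ p → p ∈ S → IsPalindrome (sub (colouring q m) p)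
    colouring-palindromic p p∈S = colouring-palindrome {q} {m} p (All.lookup S⊆ p∈S) (unmarked-or-centred p∈S)
  ... | c , eq = colouring-not-recolouring q<K N≤m c eq

module Scales (K : ℕ) where

  scale : ℕ → ℕ
  scale i = 2 ^ ((K + 3) * i)

  exponent : ℕ → ℕ
  exponent i = (K + 3) * i + K

  scale-mono : ∀ {i j} → i ≤ j → scale i ≤ scale j
  scale-mono i≤j = ^-monoʳ-≤ 2 (*-monoʳ-≤ (K + 3) i≤j)

  scale-suc : ∀ i → scale (suc i) ≡ 2 ^ (3 + exponent i)
  scale-suc i = cong (2 ^_) ((K + 3) * suc i ≡ 3 + ((K + 3) * i + K) ∋ solve (K ∷ i ∷ []))

  spread : ∀ i → 4 * suc K * scale i ≤ 2 ^ (2 + exponent i)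
  spread i = begin
    4 * suc K * scale i              ≡⟨ regroup K (scale i) ⟩
    2 * (2 * (scale i * suc K))      ≤⟨ *-monoʳ-≤ 2 (*-monoʳ-≤ 2 (*-monoʳ-≤ (scale i) (n<2^n K))) ⟩
    2 * (2 * (scale i * 2 ^ K))      ≡⟨ cong (λ z → 2 * (2 * z)) (^-distribˡ-+-* 2 ((K + 3) * i) K) ⟨
    2 ^ (2 + exponent i)             ∎
    where
    open ≤-Reasoning
    regroup : ∀ k t → 4 * suc k * t ≡ 2 * (2 * (t * suc k))
    regroup = solve-∀

  modulus≤scale : ∀ {i} → i < K → 2 ^ (2 + exponent i) ≤ scale K
  modulus≤scale {i} i<K = begin
    2 ^ (2 + exponent i)   ≤⟨ ^-monoʳ-≤ 2 (n≤1+n (2 + exponent i)) ⟩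
    2 ^ (3 + exponent i)   ≡⟨ scale-suc i ⟨
    scale (suc i)          ≤⟨ scale-mono i<K ⟩
    scale K                ∎
    where open ≤-Reasoning

  InBand : ℕ × ℕ → ℕ → Set
  InBand p i = i < K × scale i < width p × width p < scale (suc i)

  InBand? : ∀ p i → Dec (InBand p i)
  InBand? p i = (i <? K) ×-dec (scale i <? width p) ×-dec (width p <? scale (suc i))

  band-functional : ∀ p {i i′} → InBand p i → InBand p i′ → i ≡ i′
  band-functional p {i} {i′} (_ , above , below) (_ , above′ , below′) with <-cmp i i′
  ... | tri< i<i′ _ _ = ⊥-elim (<-irrefl refl (<-trans (<-≤-trans below (scale-mono i<i′)) above′))
  ... | tri≈ _ i≡i′ _ = i≡i′
  ... | tri> _ _ i′<i = ⊥-elim (<-irrefl refl (<-trans (<-≤-trans below′ (scale-mono i′<i)) above))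

  palindrome-short-or-centred : ∀ {m i} p → InS m p → IsPalindrome (sub (tmFactor 0 m) p) → ¬ InBand p i → i < K →
                                width p ≤ scale i ⊎ 2 ^ (2 + exponent i) ∣ start p + start p + width p
  palindrome-short-or-centred {i = i} p p∈S pal not-in-band i<K with width p ≤? scale i | width p <? scale (suc i)
  ... | yes short | _         = inj₁ short
  ... | no  long  | yes below = ⊥-elim (not-in-band (i<K , ≰⇒> long , below))
  ... | no  _     | no  above = inj₂ (tm-palindrome-centre-divisible (exponent i) p p∈S pal
                                       (subst (_≤ width p) (scale-suc i) (≮⇒≥ above)))

proposition2 : (n : ℕ) → 0 < n → ∃ λ k → ∃ λ m → (0 < m) × MuAtLeast (tmFactor k m) n
proposition2 n _ = 0 , scale n , m^n>0 2 ((n + 3) * n) , μ≥n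
  where
  open Scales n
  μ≥n : MuAtLeast (tmFactor 0 (scale n)) n
  μ≥n S _ S⊆ |S|<n generates with ∃-unrelated {R = InBand} InBand? band-functional n S |S|<n
  ... | i , i<n , empty-band =
    Colouring.¬palGenerates n (scale i) (2 ^ (2 + exponent i)) {{m^n≢0 2 (2 + exponent i)}}
      (m^n>0 2 ((n + 3) * i)) (spread i) S |S|<n S⊆′ (modulus≤scale i<n)
      (λ {p} p∈S → palindrome-short-or-centred p (All.lookup S⊆′ p∈S) (proj₁ generates p p∈S) (empty-band p∈S) i<n)
      generates
    where
    S⊆′ : All (InS (scale n)) S
    S⊆′ = subst (λ m → All (InS m) S) (length-tmFactor 0 (scale n)) S⊆
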